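{- Let $B\ge1$ be real and $d$ a positive integer. Let $u,u'\in\mathbb{Z}^{d+1}\setminus\{0\}$ satisfy (a) $\|u\|_\infty,\|u'\|_\infty\le B$, and (b) there is an integer $D>2B^2$ such that all $2\times2$ minors of the $2\times(d+1)$ matrix with rows $u$ and $u'$ are divisible by $D$. Then the points of $\mathbb{P}^d(\mathbb{Q})$ represented by $u$ and $u'$ are equal.
   Formalization: The bound B ranges over the rationals rather than the reals. -}

module Defs where

open import Data.Nat using (ℕ)
open import Data.Fin using (Fin)
open import Data.Integer using (ℤ; +_; _-_; _*_)
open import Data.Integer.Divisibility using (_∣_)
open import Data.Rational using (ℚ; _/_; ∣_∣; _≤_; _<_)
import Data.Rational as ℚ
open import Data.Product using (Σ; _×_)
open import Relation.Binary.PropositionalEquality using (_≡_; _≢_)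
open import Relation.Nullary using (¬_)

Vecℤ : ℕ → Set
Vecℤ n = Fin n → ℤ

toℚ : ℤ → ℚ
toℚ z = z / 1

IsZero : {n : ℕ} → Vecℤ n → Set
IsZero u = ∀ i → u i ≡ + 0

SupNormLe : {n : ℕ} → Vecℤ n → ℚ → Set
SupNormLe u B = ∀ i → ∣ toℚ (u i) ∣ ≤ B

MinorsDivisibleBy : {n : ℕ} → ℤ → Vecℤ n → Vecℤ n → Set
MinorsDivisibleBy D u u' = ∀ i j → D ∣ (u i * u' j - u j * u' i)

-- u and u' represent the same point of ℙ^(n-1)(ℚ): u' = λ u for some λ ∈ ℚ, λ ≠ 0
SameProjPoint : {n : ℕ} → Vecℤ n → Vecℤ n → Set
SameProjPoint u u' = Σ ℚ λ c → (c ≢ ℚ.0ℚ) × (∀ i → toℚ (u' i) ≡ c ℚ.* toℚ (u i))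

{-# OPTIONS --safe #-}
-- Every minor u i u' j - u j u' i has absolute value at most 2B² < D, so being
-- divisible by D it vanishes.  Two nonzero vectors all of whose 2×2 minors vanish
-- are proportional, with ratio u' k / u k for any k with u k ≠ 0.
module Submission where

open import Defs
open import Data.Nat using (ℕ; suc)
open import Data.Integer using (ℤ)
open import Data.Rational using (ℚ; 1ℚ; _≤_; _<_; _*_)
open import Relation.Nullary using (¬_)

open import Data.Nat.Coprimality as Coprimality using (1-coprimeTo)
open import Data.Nat.Divisibility using (>⇒∤)
open import Data.Integer as ℤ using (+_; -[1+_]; +<+; 0ℤ)
open import Data.Integer.Properties as ℤ using (∣i∣≡0⇒i≡0; i-j≡0⇒i≡j)
import Data.Integer.Divisibility as ℤ
open import Data.Rational as ℚ using (0ℚ; ∣_∣; toℚᵘ; NonZero; 1/_)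
open import Data.Rational.Properties as ℚ
  using (normalize-coprime; toℚᵘ-injective; *-identityʳ; *-inverseʳ; *-assoc; *-comm)
open import Data.Rational.Unnormalised as ℚᵘ using (mkℚᵘ; *≡*; *<*)
import Data.Rational.Unnormalised.Properties as ℚᵘ
open import Data.Fin.Properties using (¬∀⟶∃¬)
open import Data.Product using (_,_)
open import Relation.Binary.PropositionalEquality
open import Relation.Nullary using (contradiction)

toℚᵘ-toℚ : ∀ z → toℚᵘ (toℚ z) ≡ mkℚᵘ z 0
toℚᵘ-toℚ (+ n) = cong toℚᵘ (normalize-coprime (Coprimality.sym (1-coprimeTo n)))
toℚᵘ-toℚ -[1+ n ] rewrite normalize-coprime (Coprimality.sym (1-coprimeTo (suc n))) = refl

toℚ-injective : ∀ {a b} → toℚ a ≡ toℚ b → a ≡ b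
toℚ-injective {a} {b} eq = cong ℚᵘ.↥_ (begin
  mkℚᵘ a 0       ≡⟨ toℚᵘ-toℚ a ⟨
  toℚᵘ (toℚ a)   ≡⟨ cong toℚᵘ eq ⟩
  toℚᵘ (toℚ b)   ≡⟨ toℚᵘ-toℚ b ⟩
  mkℚᵘ b 0       ∎)
  where open ≡-Reasoning

toℚ-homo-* : ∀ a b → toℚ (a ℤ.* b) ≡ toℚ a * toℚ b
toℚ-homo-* a b = toℚᵘ-injective (begin
  toℚᵘ (toℚ (a ℤ.* b))            ≡⟨ toℚᵘ-toℚ (a ℤ.* b) ⟩
  mkℚᵘ (a ℤ.* b) 0                ≡⟨ cong₂ ℚᵘ._*_ (toℚᵘ-toℚ a) (toℚᵘ-toℚ b) ⟨
  toℚᵘ (toℚ a) ℚᵘ.* toℚᵘ (toℚ b)  ≈⟨ ℚ.toℚᵘ-homo-* (toℚ a) (toℚ b) ⟨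
  toℚᵘ (toℚ a * toℚ b)            ∎)
  where open ℚᵘ.≃-Reasoning

toℚ-homo-- : ∀ a b → toℚ (a ℤ.- b) ≡ toℚ a ℚ.- toℚ b
toℚ-homo-- a b = toℚᵘ-injective (begin
  toℚᵘ (toℚ (a ℤ.- b))                  ≡⟨ toℚᵘ-toℚ (a ℤ.- b) ⟩
  mkℚᵘ (a ℤ.- b) 0                      ≈⟨ *≡* (cong (ℤ._* + 1) (cong₂ ℤ._+_
                                              (sym (ℤ.*-identityʳ a)) (sym (ℤ.*-identityʳ (ℤ.- b))))) ⟩
  mkℚᵘ a 0 ℚᵘ.- mkℚᵘ b 0                ≡⟨ cong₂ ℚᵘ._-_ (toℚᵘ-toℚ a) (toℚᵘ-toℚ b) ⟨
  toℚᵘ (toℚ a) ℚᵘ.- toℚᵘ (toℚ b)        ≈⟨ ℚᵘ.+-congʳ (toℚᵘ (toℚ a)) (ℚ.toℚᵘ-homo‿- (toℚ b)) ⟨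
  toℚᵘ (toℚ a) ℚᵘ.+ toℚᵘ (ℚ.- toℚ b)   ≈⟨ ℚ.toℚᵘ-homo-+ (toℚ a) (ℚ.- toℚ b) ⟨
  toℚᵘ (toℚ a ℚ.- toℚ b)               ∎)
  where open ℚᵘ.≃-Reasoning

toℚ-homo-∣-∣ : ∀ z → ∣ toℚ z ∣ ≡ toℚ (+ ℤ.∣ z ∣)
toℚ-homo-∣-∣ z = toℚᵘ-injective (begin
  toℚᵘ ∣ toℚ z ∣            ≈⟨ ℚ.toℚᵘ-homo-∣-∣ (toℚ z) ⟩
  ℚᵘ.∣ toℚᵘ (toℚ z) ∣       ≡⟨ cong ℚᵘ.∣_∣ (toℚᵘ-toℚ z) ⟩
  mkℚᵘ (+ ℤ.∣ z ∣) 0        ≡⟨ toℚᵘ-toℚ (+ ℤ.∣ z ∣) ⟨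
  toℚᵘ (toℚ (+ ℤ.∣ z ∣))    ∎)
  where open ℚᵘ.≃-Reasoning

toℚ-cancel-< : ∀ {a b} → toℚ a < toℚ b → a ℤ.< b
toℚ-cancel-< {a} {b} a<b
  with subst₂ ℚᵘ._<_ (toℚᵘ-toℚ a) (toℚᵘ-toℚ b) (ℚ.toℚᵘ-mono-< a<b)
... | *<* a*1<b*1 = subst₂ ℤ._<_ (ℤ.*-identityʳ a) (ℤ.*-identityʳ b) a*1<b*1

∣p∣≤r⇒∣q∣≤r⇒∣p*q∣≤r*r : ∀ {p q r} → ∣ p ∣ ≤ r → ∣ q ∣ ≤ r → ∣ p * q ∣ ≤ r * r
∣p∣≤r⇒∣q∣≤r⇒∣p*q∣≤r*r {p} {q} {r} ∣p∣≤r ∣q∣≤r = begin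
  ∣ p * q ∣       ≡⟨ ℚ.∣p*q∣≡∣p∣*∣q∣ p q ⟩
  ∣ p ∣ * ∣ q ∣   ≤⟨ ℚ.*-monoʳ-≤-nonNeg ∣ q ∣ {{ℚ.nonNegative (ℚ.0≤∣p∣ q)}} ∣p∣≤r ⟩
  r * ∣ q ∣       ≤⟨ ℚ.*-monoˡ-≤-nonNeg r {{ℚ.nonNegative 0≤r}} ∣q∣≤r ⟩
  r * r           ∎
  where
  open ℚ.≤-Reasoning
  0≤r : 0ℚ ≤ r
  0≤r = ℚ.≤-trans (ℚ.0≤∣p∣ p) ∣p∣≤r

∣pq-st∣≤2r² : ∀ {p q s t r} → ∣ p ∣ ≤ r → ∣ q ∣ ≤ r → ∣ s ∣ ≤ r → ∣ t ∣ ≤ r →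
              ∣ p * q ℚ.- s * t ∣ ≤ toℚ (+ 2) * r * r
∣pq-st∣≤2r² {p} {q} {s} {t} {r} ∣p∣≤r ∣q∣≤r ∣s∣≤r ∣t∣≤r = begin
  ∣ p * q ℚ.- s * t ∣           ≤⟨ ℚ.∣p-q∣≤∣p∣+∣q∣ (p * q) (s * t) ⟩
  ∣ p * q ∣ ℚ.+ ∣ s * t ∣       ≤⟨ ℚ.+-mono-≤ (∣p∣≤r⇒∣q∣≤r⇒∣p*q∣≤r*r ∣p∣≤r ∣q∣≤r)
                                            (∣p∣≤r⇒∣q∣≤r⇒∣p*q∣≤r*r ∣s∣≤r ∣t∣≤r) ⟩
  r * r ℚ.+ r * r               ≡⟨ cong₂ ℚ._+_ (ℚ.*-identityˡ (r * r)) (ℚ.*-identityˡ (r * r)) ⟨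
  1ℚ * (r * r) ℚ.+ 1ℚ * (r * r) ≡⟨ ℚ.*-distribʳ-+ (r * r) 1ℚ 1ℚ ⟨
  toℚ (+ 2) * (r * r)           ≡⟨ *-assoc (toℚ (+ 2)) r r ⟨
  toℚ (+ 2) * r * r             ∎
  where open ℚ.≤-Reasoning

∣i∣<j⇒j∣i⇒i≡0 : ∀ {i j} → + ℤ.∣ i ∣ ℤ.< j → j ℤ.∣ i → i ≡ 0ℤ
∣i∣<j⇒j∣i⇒i≡0 {i} (+<+ ∣i∣<k) k∣i with ℤ.∣ i ∣ in ∣i∣≡
... | 0     = ∣i∣≡0⇒i≡0 ∣i∣≡
... | suc _ = contradiction k∣i (>⇒∤ ∣i∣<k)

MinorsVanish : {n : ℕ} → Vecℤ n → Vecℤ n → Set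
MinorsVanish u u' = ∀ i j → u i ℤ.* u' j ≡ u j ℤ.* u' i

divisible-minors-vanish : ∀ {n} {u u' : Vecℤ n} {B D} → SupNormLe u B → SupNormLe u' B →
                          toℚ (+ 2) * B * B < toℚ D → MinorsDivisibleBy D u u' →
                          MinorsVanish u u'
divisible-minors-vanish {u = u} {u'} {B} {D} ∣u∣≤B ∣u'∣≤B 2B²<D D∣minor i j =
  i-j≡0⇒i≡j _ _ (∣i∣<j⇒j∣i⇒i≡0 ∣minor∣<D (D∣minor i j))
  where
  minor : ℤ
  minor = u i ℤ.* u' j ℤ.- u j ℤ.* u' i
  ∣minor∣<D : + ℤ.∣ minor ∣ ℤ.< D
  ∣minor∣<D = toℚ-cancel-< (begin-strict
    toℚ (+ ℤ.∣ minor ∣)                                    ≡⟨ toℚ-homo-∣-∣ minor ⟨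
    ∣ toℚ minor ∣                                          ≡⟨ cong ∣_∣ (toℚ-homo-- (u i ℤ.* u' j) (u j ℤ.* u' i)) ⟩
    ∣ toℚ (u i ℤ.* u' j) ℚ.- toℚ (u j ℤ.* u' i) ∣          ≡⟨ cong ∣_∣ (cong₂ ℚ._-_
                                                                (toℚ-homo-* (u i) (u' j)) (toℚ-homo-* (u j) (u' i))) ⟩
    ∣ toℚ (u i) * toℚ (u' j) ℚ.- toℚ (u j) * toℚ (u' i) ∣  ≤⟨ ∣pq-st∣≤2r² (∣u∣≤B i) (∣u'∣≤B j) (∣u∣≤B j) (∣u'∣≤B i) ⟩
    toℚ (+ 2) * B * B                                      <⟨ 2B²<D ⟩
    toℚ D                                                  ∎)
    where open ℚ.≤-Reasoning

*-proportional : ∀ a b x y .{{_ : NonZero a}} → a * y ≡ b * x → y ≡ (x * 1/ a) * b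
*-proportional a b x y ay≡bx = begin
  y                  ≡⟨ *-identityʳ y ⟨
  y * 1ℚ             ≡⟨ cong (y *_) (*-inverseʳ a) ⟨
  y * (a * 1/ a)     ≡⟨ *-assoc y a (1/ a) ⟨
  (y * a) * 1/ a     ≡⟨ cong (_* 1/ a) (trans (*-comm y a) ay≡bx) ⟩
  (b * x) * 1/ a     ≡⟨ *-assoc b x (1/ a) ⟩
  b * (x * 1/ a)     ≡⟨ *-comm b (x * 1/ a) ⟩
  (x * 1/ a) * b     ∎
  where open ≡-Reasoning

vanishing-minors⇒SameProjPoint : ∀ {n} {u u' : Vecℤ n} → ¬ IsZero u → ¬ IsZero u' →
                                 MinorsVanish u u' → SameProjPoint u u'
vanishing-minors⇒SameProjPoint {n} {u} {u'} u≢0 u'≢0 minors≡0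
  with ¬∀⟶∃¬ n (λ i → u i ≡ 0ℤ) (λ i → u i ℤ.≟ 0ℤ) u≢0
... | k , uₖ≢0 = c , c≢0 , u'≡cu
  where
  instance
    toℚuₖ≢0 : NonZero (toℚ (u k))
    toℚuₖ≢0 = ℚ.≢-nonZero (λ eq → uₖ≢0 (toℚ-injective eq))
  c : ℚ
  c = toℚ (u' k) * 1/ toℚ (u k)
  u'≡cu : ∀ j → toℚ (u' j) ≡ c * toℚ (u j)
  u'≡cu j = *-proportional (toℚ (u k)) (toℚ (u j)) (toℚ (u' k)) (toℚ (u' j)) (begin
    toℚ (u k) * toℚ (u' j)   ≡⟨ toℚ-homo-* (u k) (u' j) ⟨
    toℚ (u k ℤ.* u' j)       ≡⟨ cong toℚ (minors≡0 k j) ⟩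
    toℚ (u j ℤ.* u' k)       ≡⟨ toℚ-homo-* (u j) (u' k) ⟩
    toℚ (u j) * toℚ (u' k)   ∎)
    where open ≡-Reasoning
  c≢0 : c ≢ 0ℚ
  c≢0 c≡0 = u'≢0 λ j → toℚ-injective (begin
    toℚ (u' j)       ≡⟨ u'≡cu j ⟩
    c * toℚ (u j)    ≡⟨ cong (_* toℚ (u j)) c≡0 ⟩
    0ℚ * toℚ (u j)   ≡⟨ ℚ.*-zeroˡ (toℚ (u j)) ⟩
    toℚ 0ℤ           ∎)
    where open ≡-Reasoning

lemma3p12 : (B : ℚ) → 1ℚ ≤ B → (d : ℕ) → 1 Data.Nat.≤ d →
            (u u' : Vecℤ (suc d)) → ¬ IsZero u → ¬ IsZero u' →
            SupNormLe u B → SupNormLe u' B →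
            (D : ℤ) → (toℚ (Data.Integer.+ 2) * B * B) < toℚ D →
            MinorsDivisibleBy D u u' →
            SameProjPoint u u'
lemma3p12 _ _ _ _ u u' u≢0 u'≢0 ∣u∣≤B ∣u'∣≤B D 2B²<D D∣minors =
  vanishing-minors⇒SameProjPoint u≢0 u'≢0
    (divisible-minors-vanish {u = u} {u'} {D = D} ∣u∣≤B ∣u'∣≤B 2B²<D D∣minors)
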